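{- Let $Q=(q_n)_{n\ge1}$ be a basic sequence that is infinite in limit. For all $F_1,F_2\in\Gamma_Q$, $|x_{F_1}-x_{F_2}|\le d(F_1,F_2)$.
   Context: A basic sequence is a sequence $Q=(q_n)_{n\ge1}$ of integers with $q_n\ge 2$; it is infinite in limit if $q_n\to\infty$. For each positive integer $j$ let $\nu_j=\min\{N: q_m\ge 2j^2 \text{ for all } m\ge N\}$. Let $l_1=\max(\nu_2-1,1)$ and, recursively for $i\ge2$, let $l_i$ be the smallest positive integer $k$ with $l_1+2l_2+\cdots+(i-1)l_{i-1}+ik\ge \nu_{i+1}-1$. Put $L_0=0$, $L_i=\sum_{j=1}^i jl_j$. Let $\mathbb N=\{1,2,\dots\}$, $S_Q=\{(a,b,c)\in\mathbb N^3: b\le l_a,\ c\le a\}$ and $\phi_Q(a,b,c)=L_{a-1}+(b-1)a+c$ (a bijection $S_Q\to\mathbb N$). A $Q$-special sequence is a family of integers $F=(F_{(a,b,c)})_{(a,b,c)\in S_Q}$ with $F_{(a,b,1)}=0$ for all $(a,b,1)\in S_Q$, and $\frac{F_{(a,b,c)}}{q_{\phi_Q(a,b,c)}}\in\left[\frac{c-1}{a}-\frac{1}{2a^2},\frac{c-1}{a}+\frac{1}{2a^2}\right]$ for $(a,b,c)\in S_Q$ with $c>1$. Let $\Gamma_Q$ be the set of $Q$-special sequences. For $F\in\Gamma_Q$ put $E_{F,n}=F_{\phi_Q^{ -1}(n)}$ and $x_F=\sum_{n\ge1}\frac{E_{F,n}}{q_1\cdots q_n}$. For $F_1\ne F_2$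 in $\Gamma_Q$ let $\zeta_{F_1,F_2}=\min\{n: E_{F_1,n}\ne E_{F_2,n}\}$ and $d(F_1,F_2)=\frac{1}{q_1q_2\cdots q_{\zeta_{F_1,F_2}-1}}$ (empty product $=1$); let $d(F,F)=0$. -}

module Defs where

open import Data.Nat as ℕ using (ℕ; zero; suc; _∸_; _≤_; _<_; _⊔_)
open import Data.Integer as ℤ using (ℤ; +_)
open import Data.Rational as ℚ using (ℚ; 0ℚ)
open import Data.Product using (Σ; ∃; _×_; _,_)
open import Data.Sum using (_⊎_)
open import Relation.Binary.PropositionalEquality using (_≡_; _≢_)

-- A sequence q is given as a function ℕ → ℕ; only the values q 1, q 2, … are
-- used (q 0 is ignored everywhere).

IsBasic : (ℕ → ℕ) → Set
IsBasic q = ∀ n → 1 ≤ n → 2 ≤ q n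

InfiniteInLimit : (ℕ → ℕ) → Set
InfiniteInLimit q = ∀ M → ∃ λ N → ∀ n → N ≤ n → M ≤ q n

-- z / d as a rational, with the convention z / 0 = 0 (never used with d = 0
-- in the statement, since all denominators are positive there).
frac : ℤ → ℕ → ℚ
frac z zero = 0ℚ
frac z (suc d) = z ℚ./ suc d

prodQ : (ℕ → ℕ) → ℕ → ℕ
prodQ q zero = 1
prodQ q (suc n) = prodQ q n ℕ.* q (suc n)

IsNu : (ℕ → ℕ) → ℕ → ℕ → Set
IsNu q j N =
  1 ≤ N × (∀ m → N ≤ m → 2 ℕ.* (j ℕ.* j) ≤ q m)
        × (∀ N' → 1 ≤ N' → (∀ m → N' ≤ m → 2 ℕ.* (j ℕ.* j) ≤ q m) → N ≤ N')

bigL : (ℕ → ℕ) → ℕ → ℕ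
bigL l zero = 0
bigL l (suc i) = bigL l i ℕ.+ suc i ℕ.* l (suc i)

IsL : (ν : ℕ → ℕ) → (l : ℕ → ℕ) → Set
IsL ν l =
  (l 1 ≡ (ν 2 ∸ 1) ⊔ 1)
  × (∀ i → 2 ≤ i →
       1 ≤ l i
       × ν (suc i) ∸ 1 ≤ bigL l (i ∸ 1) ℕ.+ i ℕ.* l i
       × (∀ k → 1 ≤ k → ν (suc i) ∸ 1 ≤ bigL l (i ∸ 1) ℕ.+ i ℕ.* k → l i ≤ k))

InS : (l : ℕ → ℕ) → ℕ → ℕ → ℕ → Set
InS l a b c = (1 ≤ a × 1 ≤ b × 1 ≤ c) × (b ≤ l a × c ≤ a)

phi : (l : ℕ → ℕ) → ℕ → ℕ → ℕ → ℕ
phi l a b c = bigL l (a ∸ 1) ℕ.+ (b ∸ 1) ℕ.* a ℕ.+ c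

-- Q-special sequences, as families F (a,b,c) (values outside S_Q irrelevant)
IsSpecial : (q l : ℕ → ℕ) → (ℕ → ℕ → ℕ → ℤ) → Set
IsSpecial q l F =
  (∀ a b → InS l a b 1 → F a b 1 ≡ + 0)
  × (∀ a b c → InS l a b c → 2 ≤ c →
       (frac (+ (c ∸ 1)) a ℚ.- frac (+ 1) (2 ℕ.* (a ℕ.* a))
          ℚ.≤ frac (F a b c) (q (phi l a b c)))
       × (frac (F a b c) (q (phi l a b c))
          ℚ.≤ frac (+ (c ∸ 1)) a ℚ.+ frac (+ 1) (2 ℕ.* (a ℕ.* a))))

IsDigits : (l : ℕ → ℕ) → (ℕ → ℕ → ℕ → ℤ) → (ℕ → ℤ) → Set
IsDigits l F E = ∀ a b c → InS l a b c → E (phi l a b c) ≡ F a b c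

partialSum : (q : ℕ → ℕ) → (ℕ → ℤ) → ℕ → ℚ
partialSum q E zero = 0ℚ
partialSum q E (suc N) = partialSum q E N ℚ.+ frac (E (suc N)) (prodQ q (suc N))

SameOnS : (l : ℕ → ℕ) → (F₁ F₂ : ℕ → ℕ → ℕ → ℤ) → Set
SameOnS l F₁ F₂ = ∀ a b c → InS l a b c → F₁ a b c ≡ F₂ a b c

IsZeta : (E₁ E₂ : ℕ → ℤ) → ℕ → Set
IsZeta E₁ E₂ ζ = 1 ≤ ζ × E₁ ζ ≢ E₂ ζ × (∀ n → 1 ≤ n → n < ζ → E₁ n ≡ E₂ n)

IsDist : (q l : ℕ → ℕ) → (F₁ F₂ : ℕ → ℕ → ℕ → ℤ) → (E₁ E₂ : ℕ → ℤ) → ℚ → Set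
IsDist q l F₁ F₂ E₁ E₂ δ =
  (SameOnS l F₁ F₂ × δ ≡ 0ℚ)
  ⊎ (∃ λ ζ → IsZeta E₁ E₂ ζ × δ ≡ frac (+ 1) (prodQ q (ζ ∸ 1)))

-- |lim s₁ - lim s₂| ≤ δ, for convergent sequences of partial sums s₁, s₂,
-- expressed without reals: for every ε > 0, eventually |s₁ n - s₂ n| ≤ δ + ε.
LimAbsDiffLe : (s₁ s₂ : ℕ → ℚ) → ℚ → Set
LimAbsDiffLe s₁ s₂ δ =
  ∀ ε → 0ℚ ℚ.< ε → ∃ λ N → ∀ n → N ≤ n → ℚ.∣ s₁ n ℚ.- s₂ n ∣ ℚ.≤ δ ℚ.+ ε

module Submission where

-- Write s_i(n) = Σ_{k ≤ n} E_i(k) / (q₁⋯q_k) for the partial sums of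
-- x_{F_i}.  The bound |x_{F₁} - x_{F₂}| ≤ d(F₁,F₂) follows from the uniform bound
-- |s₁(n) - s₂(n)| ≤ d(F₁,F₂) for all large n.
--   * φ_Q enumerates S_Q in lexicographic order and hits every positive integer,
--     so every digit E(n), n ≥ 1, is a value F(a,b,c) at a position φ(a,b,c) = n.
--   * Every value of a Q-special sequence lies in [0, q_{φ(a,b,c)}): for c ≥ 2
--     the window [(c-1)/a - 1/(2a²), (c-1)/a + 1/(2a²)] lies in [0,1).  Hence two
--     digits at position n differ by less than q_n.
--   * Over the common denominator q₁⋯q_n the partial sum s(n) has the Horner
--     numerator N(n) = N(n-1)·q_n + E(n), which is linear in the digits.  If the
--     digit differences vanish up to m and are below the bases afterwards, the
--     numerator of s₁ - s₂ at m + k is below q_{m+1}⋯q_{m+k}, which gives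
--     |s₁(m+k) - s₂(m+k)| ≤ 1/(q₁⋯q_m).
-- The theorem follows: if F₁ = F₂ the partial sums coincide, and otherwise the
-- digits agree before ζ, so the partial sums are eventually within 1/(q₁⋯q_{ζ-1}).

open import Defs
open import Data.Nat using (ℕ; _≤_)
open import Data.Integer using (ℤ)
open import Data.Rational using (ℚ)
open import Data.Nat as ℕ using (zero; suc; _+_; _*_; _∸_; _<_; z≤n; s≤s)
import Data.Nat.Properties as ℕP
import Data.Nat.Tactic.RingSolver as ℕSolver
open import Data.Integer as ℤ using (+_; -[1+_]; +≤+; +<+)
import Data.Integer.Properties as ℤP
import Data.Integer.Tactic.RingSolver as ℤSolver
open import Data.Rational as ℚ using (0ℚ; 1ℚ; toℚᵘ)
import Data.Rational.Properties as ℚP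
open import Data.Rational.Unnormalised as ℚᵘ using (mkℚᵘ; *≡*; *≤*; *<*)
import Data.Rational.Unnormalised.Properties as ℚᵘP
open import Data.List using (_∷_; [])
open import Data.Product using (Σ; _×_; _,_; proj₁)
open import Data.Sum using (inj₁; inj₂)
open import Relation.Binary.PropositionalEquality
open import Relation.Nullary using (yes; no)

NonemptyLevels : (ℕ → ℕ) → Set
NonemptyLevels l = ∀ a → 1 ≤ a → 1 ≤ l a

blockCountPositive : ∀ {ν l} → IsL ν l → NonemptyLevels l
blockCountPositive {ν} (l₁≡ , _) 1 _ rewrite l₁≡ = ℕP.m≤n⊔m (ν 2 ∸ 1) 1
blockCountPositive (_ , lᵢ) (suc (suc a)) _ = proj₁ (lᵢ (suc (suc a)) (s≤s (s≤s z≤n)))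

PhiPreimage : (ℕ → ℕ) → ℕ → Set
PhiPreimage l n = Σ ℕ λ a → Σ ℕ λ b → Σ ℕ λ c → InS l a b c × phi l a b c ≡ n

phi-positive : ∀ l a b c → 1 ≤ c → 1 ≤ phi l a b c
phi-positive l a b c 1≤c = ℕP.≤-trans 1≤c (ℕP.m≤n+m c _)

-- After the last entry (c = a) of block b of level a comes the first entry of
-- block b + 1; written with a, b shifted by one.
phi-nextBlock : ∀ L a b → L + suc b * suc a + 1 ≡ suc (L + b * suc a + suc a)
phi-nextBlock = ℕSolver.solve-∀

-- After the last block (b = l_a) of level a comes level a + 1, whose first entry
-- sits at L_a + 1 = L_{a-1} + a·l_a + 1.
phi-nextLevel : ∀ L a b → L + suc a * suc b + 0 + 1 ≡ suc (L + b * suc a + suc a)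
phi-nextLevel = ℕSolver.solve-∀

-- φ_Q is the lexicographic enumeration: the position after φ(a,b,c) is
-- φ(a,b,c+1), φ(a,b+1,1) or φ(a+1,1,1).
phi-successor : ∀ {l} → NonemptyLevels l → ∀ a b c → InS l a b c → PhiPreimage l (suc (phi l a b c))
phi-successor nonempty zero b c ((() , _) , _)
phi-successor nonempty (suc a) zero c ((_ , () , _) , _)
phi-successor nonempty (suc a) (suc b) zero ((_ , _ , ()) , _)
phi-successor {l = l} nonempty (suc a) (suc b) (suc c) (_ , (b≤l , c≤a)) with suc c ℕP.<? suc a
... | yes c<a = suc a , suc b , suc (suc c) , ((s≤s z≤n , s≤s z≤n , s≤s z≤n) , (b≤l , c<a)) ,
                ℕP.+-suc (bigL l a + b * suc a) (suc c)
... | no c≮a with ℕP.≤-antisym c≤a (ℕP.≮⇒≥ c≮a)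
...   | refl with suc b ℕP.<? l (suc a)
...     | yes b<l = suc a , suc (suc b) , 1 , ((s≤s z≤n , s≤s z≤n , s≤s z≤n) , (b<l , s≤s z≤n)) ,
                    phi-nextBlock (bigL l a) a b
...     | no b≮l = suc (suc a) , 1 , 1 ,
                   ((s≤s z≤n , s≤s z≤n , s≤s z≤n) , (nonempty (suc (suc a)) (s≤s z≤n) , s≤s z≤n)) ,
                   subst (λ lₐ → bigL l a + suc a * lₐ + 0 + 1 ≡ suc (bigL l a + b * suc a + suc a))
                         (ℕP.≤-antisym b≤l (ℕP.≮⇒≥ b≮l)) (phi-nextLevel (bigL l a) a b)

phi-surjective : ∀ {l} → NonemptyLevels l → ∀ n → 1 ≤ n → PhiPreimage l n
phi-surjective nonempty (suc zero) _ =
  1 , 1 , 1 , ((s≤s z≤n , s≤s z≤n , s≤s z≤n) , (nonempty 1 (s≤s z≤n) , s≤s z≤n)) , refl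
phi-surjective {l = l} nonempty (suc (suc n)) _ with phi-surjective nonempty (suc n) (s≤s z≤n)
... | a , b , c , abc∈S , φ≡ = subst (λ m → PhiPreimage l (suc m)) φ≡ (phi-successor nonempty a b c abc∈S)

digitsInherit : ∀ {l F E} (P : ℕ → ℤ → Set) → NonemptyLevels l → IsDigits l F E →
                (∀ a b c → InS l a b c → P (phi l a b c) (F a b c)) → ∀ n → 1 ≤ n → P n (E n)
digitsInherit {l = l} {E = E} P nonempty digits holds n 1≤n with phi-surjective nonempty n 1≤n
... | a , b , c , abc∈S , refl = subst (P (phi l a b c)) (sym (digits a b c abc∈S)) (holds a b c abc∈S)

frac≃ : ∀ z P → 1 ≤ P → toℚᵘ (frac z P) ℚᵘ.≃ mkℚᵘ z (P ∸ 1)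
frac≃ z (suc p) _ = ℚP.toℚᵘ-fromℚᵘ (mkℚᵘ z p)

basePositive : ∀ {q} → IsBasic q → ∀ n → 1 ≤ n → 1 ≤ q n
basePositive basic n 1≤n = ℕP.≤-trans (s≤s z≤n) (basic n 1≤n)

DigitIn : ℕ → ℤ → Set
DigitIn Q e = (+ 0 ℤ.≤ e) × (e ℤ.< + Q)

numeratorInRange : ∀ z Q → 1 ≤ Q → 0ℚ ℚ.≤ frac z Q → frac z Q ℚ.< 1ℚ → DigitIn Q z
numeratorInRange z Q@(suc p) 1≤Q 0≤z/Q z/Q<1 =
  nonNegative (ℚᵘP.≤-respʳ-≃ (frac≃ z Q 1≤Q) (ℚP.toℚᵘ-mono-≤ 0≤z/Q)) ,
  belowOne (ℚᵘP.<-respˡ-≃ (frac≃ z Q 1≤Q) (ℚP.toℚᵘ-mono-< z/Q<1))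
  where
  nonNegative : ℚᵘ.0ℚᵘ ℚᵘ.≤ mkℚᵘ z p → + 0 ℤ.≤ z
  nonNegative (*≤* 0≤z) = subst (+ 0 ℤ.≤_) (ℤP.*-identityʳ z) 0≤z
  belowOne : mkℚᵘ z p ℚᵘ.< ℚᵘ.1ℚᵘ → z ℤ.< + Q
  belowOne (*<* z<Q) = subst₂ ℤ._<_ (ℤP.*-identityʳ z) (ℤP.*-identityˡ (+ Q)) z<Q

windowStartNonnegative : ∀ a c → 1 ≤ a → 1 ≤ c →
                         0ℚ ℚ.≤ frac (+ c) a ℚ.- frac (+ 1) (2 * (a * a))
windowStartNonnegative a@(suc a-1) c@(suc _) 1≤a _ = ℚP.toℚᵘ-cancel-≤ (let open ℚᵘP.≤-Reasoning in begin
  ℚᵘ.0ℚᵘ                                             ≤⟨ ℚᵘP.p≤q⇒0≤q-p radius≤centre ⟩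
  mkℚᵘ (+ c) a-1 ℚᵘ.- mkℚᵘ (+ 1) (A ∸ 1)             ≃⟨ ℚᵘP.+-cong (frac≃ (+ c) a 1≤a) negatedRadius ⟨
  toℚᵘ (frac (+ c) a) ℚᵘ.+ toℚᵘ (ℚ.- frac (+ 1) A)    ≃⟨ ℚP.toℚᵘ-homo-+ (frac (+ c) a) (ℚ.- frac (+ 1) A) ⟨
  toℚᵘ (frac (+ c) a ℚ.- frac (+ 1) A)               ∎)
  where
  A = 2 * (a * a)
  a≤cA : a ≤ c * A
  a≤cA = ℕP.≤-trans (ℕP.m≤m*n a a) (ℕP.≤-trans (ℕP.m≤m+n (a * a) _) (ℕP.m≤n*m A c))
  negatedRadius : toℚᵘ (ℚ.- frac (+ 1) A) ℚᵘ.≃ ℚᵘ.- mkℚᵘ (+ 1) (A ∸ 1)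
  negatedRadius = ℚᵘP.≃-trans (ℚP.toℚᵘ-homo‿- (frac (+ 1) A)) (ℚᵘP.-‿cong (frac≃ (+ 1) A (s≤s z≤n)))
  radius≤centre : mkℚᵘ (+ 1) (A ∸ 1) ℚᵘ.≤ mkℚᵘ (+ c) a-1
  radius≤centre = *≤* (subst₂ ℤ._≤_ (sym (ℤP.*-identityˡ (+ a))) (ℤP.pos-* c A) (+≤+ a≤cA))

windowEndBelowOne : ∀ a c → c < a → frac (+ c) a ℚ.+ frac (+ 1) (2 * (a * a)) ℚ.< 1ℚ
windowEndBelowOne a@(suc a-1) c c<a = ℚP.toℚᵘ-cancel-< (let open ℚᵘP.≤-Reasoning in begin-strict
  toℚᵘ (frac (+ c) a ℚ.+ frac (+ 1) A)          ≃⟨ ℚP.toℚᵘ-homo-+ (frac (+ c) a) (frac (+ 1) A) ⟩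
  toℚᵘ (frac (+ c) a) ℚᵘ.+ toℚᵘ (frac (+ 1) A)  ≃⟨ ℚᵘP.+-cong (frac≃ (+ c) a (s≤s z≤n)) (frac≃ (+ 1) A (s≤s z≤n)) ⟩
  mkℚᵘ (+ c) a-1 ℚᵘ.+ mkℚᵘ (+ 1) (A ∸ 1)         <⟨ *<* (subst₂ ℤ._<_ (sym crossLeft≡) (sym crossRight≡) (+<+ cA+a<aA)) ⟩
  ℚᵘ.1ℚᵘ                                        ∎)
  where
  A = 2 * (a * a)
  a<A : a < A
  a<A = ℕP.<-≤-trans (ℕP.m<m+n a (ℕP.n≢0⇒n>0 λ ()))
          (ℕP.+-mono-≤ (ℕP.m≤m*n a a) (ℕP.≤-trans (ℕP.m≤m*n a a) (ℕP.m≤m+n (a * a) 0)))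
  -- c·A + a < c·A + A = (c+1)·A ≤ a·A
  cA+a<aA : c * A + a < a * A
  cA+a<aA = ℕP.<-≤-trans (ℕP.+-monoʳ-< (c * A) a<A)
              (ℕP.≤-trans (ℕP.≤-reflexive (ℕP.+-comm (c * A) A)) (ℕP.*-monoˡ-≤ A c<a))
  crossLeft≡ : (+ c ℤ.* + A ℤ.+ + 1 ℤ.* + a) ℤ.* + 1 ≡ + (c * A + a)
  crossLeft≡ = begin
    (+ c ℤ.* + A ℤ.+ + 1 ℤ.* + a) ℤ.* + 1  ≡⟨ ℤP.*-identityʳ _ ⟩
    + c ℤ.* + A ℤ.+ + 1 ℤ.* + a            ≡⟨ cong₂ ℤ._+_ (sym (ℤP.pos-* c A)) (ℤP.*-identityˡ (+ a)) ⟩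
    + (c * A) ℤ.+ + a                      ≡⟨ ℤP.pos-+ (c * A) a ⟨
    + (c * A + a)                          ∎
    where open ≡-Reasoning
  crossRight≡ : + 1 ℤ.* (+ a ℤ.* + A) ≡ + (a * A)
  crossRight≡ = trans (ℤP.*-identityˡ _) (sym (ℤP.pos-* a A))

-- Every value of a Q-special sequence is an admissible digit for the base at its
-- position: F(a,b,1) = 0, and for c ≥ 2, F(a,b,c)/q_φ lies in a window inside [0,1).
specialValueInRange : ∀ {q l F} → IsBasic q → IsSpecial q l F →
                      ∀ a b c → InS l a b c → DigitIn (q (phi l a b c)) (F a b c)
specialValueInRange {q} {l} basic (firstZero , _) a b 1 abc∈S
  rewrite firstZero a b abc∈S = +≤+ z≤n , +<+ (basePositive basic (phi l a b 1) (phi-positive l a b 1 ℕP.≤-refl))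
specialValueInRange {q} {l} {F} basic (_ , inWindow) a b c@(suc c-1@(suc _)) abc∈S@((1≤a , _) , (_ , c≤a))
  with inWindow a b c abc∈S (s≤s (s≤s z≤n))
... | lower , upper =
  numeratorInRange (F a b c) (q (phi l a b c)) (basePositive basic (phi l a b c) (phi-positive l a b c (s≤s z≤n)))
    (ℚP.≤-trans (windowStartNonnegative a c-1 1≤a (s≤s z≤n)) lower)
    (ℚP.≤-<-trans upper (windowEndBelowOne a c-1 c≤a))

digitDifference : ∀ {Q x y} → DigitIn Q x → DigitIn Q y → ℤ.∣ x ℤ.- y ∣ < Q
digitDifference {x = -[1+ _ ]} (() , _) _
digitDifference {x = + _} {y = -[1+ _ ]} _ (() , _)
digitDifference {x = + m} {y = + n} (_ , +<+ m<Q) (_ , +<+ n<Q) =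
  ℕP.≤-<-trans (subst (ℕ._≤ m ℕ.⊔ n) (cong ℤ.∣_∣ (sym (ℤP.m-n≡m⊖n m n))) (ℤP.∣m⊝n∣≤m⊔n m n)) (ℕP.⊔-lub m<Q n<Q)

-- The Horner numerator: partialSum q E n = numerator q E n / (q₁⋯qₙ).
numerator : (ℕ → ℕ) → (ℕ → ℤ) → ℕ → ℤ
numerator q E zero = + 0
numerator q E (suc n) = numerator q E n ℤ.* + q (suc n) ℤ.+ E (suc n)

prodQ-positive : ∀ {q} → IsBasic q → ∀ n → 1 ≤ prodQ q n
prodQ-positive basic zero = s≤s z≤n
prodQ-positive basic (suc n) = ℕP.*-mono-≤ (prodQ-positive basic n) (basePositive basic (suc n) (s≤s z≤n))

addDigit≃ : ∀ A e P Q → 1 ≤ P → 1 ≤ Q →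
            mkℚᵘ A (P ∸ 1) ℚᵘ.+ mkℚᵘ e (P * Q ∸ 1) ℚᵘ.≃ mkℚᵘ (A ℤ.* + Q ℤ.+ e) (P * Q ∸ 1)
addDigit≃ A e P@(suc _) Q@(suc _) _ _ = *≡* (addDigit-identity (+ P) (+ Q) (+ (P * Q)) (ℤP.pos-* P Q))
  where
  -- the cross-multiplied identity, with PQ kept abstract so that it matches the
  -- denominator computed by unnormalised addition
  addDigit-identity : ∀ P Q PQ → PQ ≡ P ℤ.* Q →
                      (A ℤ.* PQ ℤ.+ e ℤ.* P) ℤ.* PQ ≡ (A ℤ.* Q ℤ.+ e) ℤ.* (P ℤ.* PQ)
  addDigit-identity P Q _ refl = ℤSolver.solve (A ∷ e ∷ P ∷ Q ∷ [])

partialSum≃ : ∀ {q} → IsBasic q → ∀ E n →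
              toℚᵘ (partialSum q E n) ℚᵘ.≃ mkℚᵘ (numerator q E n) (prodQ q n ∸ 1)
partialSum≃ basic E zero = *≡* refl
partialSum≃ {q} basic E (suc n) = begin-equality
  toℚᵘ (partialSum q E n ℚ.+ frac (E (suc n)) (prodQ q (suc n)))
    ≃⟨ ℚP.toℚᵘ-homo-+ (partialSum q E n) (frac (E (suc n)) (prodQ q (suc n))) ⟩
  toℚᵘ (partialSum q E n) ℚᵘ.+ toℚᵘ (frac (E (suc n)) (prodQ q (suc n)))
    ≃⟨ ℚᵘP.+-cong (partialSum≃ basic E n) (frac≃ (E (suc n)) (prodQ q (suc n)) (prodQ-positive basic (suc n))) ⟩
  mkℚᵘ (numerator q E n) (prodQ q n ∸ 1) ℚᵘ.+ mkℚᵘ (E (suc n)) (prodQ q (suc n) ∸ 1)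
    ≃⟨ addDigit≃ (numerator q E n) (E (suc n)) (prodQ q n) (q (suc n))
                 (prodQ-positive basic n) (basePositive basic (suc n) (s≤s z≤n)) ⟩
  mkℚᵘ (numerator q E (suc n)) (prodQ q (suc n) ∸ 1) ∎
  where open ℚᵘP.≤-Reasoning

numerator-difference : ∀ q E₁ E₂ n →
  numerator q E₁ n ℤ.- numerator q E₂ n ≡ numerator q (λ k → E₁ k ℤ.- E₂ k) n
numerator-difference q E₁ E₂ zero = refl
numerator-difference q E₁ E₂ (suc n) = begin
  (N₁ ℤ.* Q ℤ.+ e₁) ℤ.- (N₂ ℤ.* Q ℤ.+ e₂)  ≡⟨ regroup N₁ N₂ Q e₁ e₂ ⟩
  (N₁ ℤ.- N₂) ℤ.* Q ℤ.+ (e₁ ℤ.- e₂)        ≡⟨ cong (λ N → N ℤ.* Q ℤ.+ (e₁ ℤ.- e₂)) (numerator-difference q E₁ E₂ n) ⟩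
  numerator q (λ k → E₁ k ℤ.- E₂ k) (suc n) ∎
  where
  open ≡-Reasoning
  regroup : ∀ x₁ x₂ y z₁ z₂ → (x₁ ℤ.* y ℤ.+ z₁) ℤ.- (x₂ ℤ.* y ℤ.+ z₂) ≡ (x₁ ℤ.- x₂) ℤ.* y ℤ.+ (z₁ ℤ.- z₂)
  regroup = ℤSolver.solve-∀
  N₁ = numerator q E₁ n
  N₂ = numerator q E₂ n
  Q = + q (suc n)
  e₁ = E₁ (suc n)
  e₂ = E₂ (suc n)

subtract≃ : ∀ A B P → 1 ≤ P → mkℚᵘ A (P ∸ 1) ℚᵘ.- mkℚᵘ B (P ∸ 1) ℚᵘ.≃ mkℚᵘ (A ℤ.- B) (P ∸ 1)
subtract≃ A B P@(suc _) _ = *≡* (subtract-identity (+ P) (+ (P * P)) (ℤP.pos-* P P))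
  where
  subtract-identity : ∀ P PP → PP ≡ P ℤ.* P → (A ℤ.* P ℤ.+ ℤ.- B ℤ.* P) ℤ.* P ≡ (A ℤ.- B) ℤ.* PP
  subtract-identity P _ refl = ℤSolver.solve (A ∷ B ∷ P ∷ [])

partialSumDifference≃ : ∀ {q} → IsBasic q → ∀ E₁ E₂ n →
  toℚᵘ (partialSum q E₁ n ℚ.- partialSum q E₂ n) ℚᵘ.≃ mkℚᵘ (numerator q (λ k → E₁ k ℤ.- E₂ k) n) (prodQ q n ∸ 1)
partialSumDifference≃ {q} basic E₁ E₂ n = begin-equality
  toℚᵘ (s₁ ℚ.- s₂)                   ≃⟨ ℚP.toℚᵘ-homo-+ s₁ (ℚ.- s₂) ⟩
  toℚᵘ s₁ ℚᵘ.+ toℚᵘ (ℚ.- s₂)          ≃⟨ ℚᵘP.+-cong (partialSum≃ basic E₁ n)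
                                          (ℚᵘP.≃-trans (ℚP.toℚᵘ-homo‿- s₂) (ℚᵘP.-‿cong (partialSum≃ basic E₂ n))) ⟩
  mkℚᵘ N₁ (P ∸ 1) ℚᵘ.- mkℚᵘ N₂ (P ∸ 1) ≃⟨ subtract≃ N₁ N₂ P (prodQ-positive basic n) ⟩
  mkℚᵘ (N₁ ℤ.- N₂) (P ∸ 1)             ≡⟨ cong (λ N → mkℚᵘ N (P ∸ 1)) (numerator-difference q E₁ E₂ n) ⟩
  mkℚᵘ (numerator q (λ k → E₁ k ℤ.- E₂ k) n) (P ∸ 1) ∎
  where
  open ℚᵘP.≤-Reasoning
  s₁ = partialSum q E₁ n
  s₂ = partialSum q E₂ n
  N₁ = numerator q E₁ n
  N₂ = numerator q E₂ n
  P = prodQ q n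

numerator-vanishes : ∀ q D m → (∀ n → 1 ≤ n → n ≤ m → D n ≡ + 0) → numerator q D m ≡ + 0
numerator-vanishes q D zero _ = refl
numerator-vanishes q D (suc m) vanish =
  cong₂ (λ N e → N ℤ.* + q (suc m) ℤ.+ e)
        (numerator-vanishes q D m (λ n 1≤n n≤m → vanish n 1≤n (ℕP.m≤n⇒m≤1+n n≤m)))
        (vanish (suc m) (s≤s z≤n) ℕP.≤-refl)

prodFrom : (ℕ → ℕ) → ℕ → ℕ → ℕ
prodFrom q m zero = 1
prodFrom q m (suc k) = prodFrom q m k * q (suc (m + k))

prodQ-split : ∀ q m k → prodQ q (m + k) ≡ prodQ q m * prodFrom q m k
prodQ-split q m zero = trans (cong (prodQ q) (ℕP.+-identityʳ m)) (sym (ℕP.*-identityʳ (prodQ q m)))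
prodQ-split q m (suc k) = begin
  prodQ q (m + suc k)                              ≡⟨ cong (prodQ q) (ℕP.+-suc m k) ⟩
  prodQ q (m + k) * q (suc (m + k))                ≡⟨ cong (_* q (suc (m + k))) (prodQ-split q m k) ⟩
  prodQ q m * prodFrom q m k * q (suc (m + k))     ≡⟨ ℕP.*-assoc (prodQ q m) (prodFrom q m k) (q (suc (m + k))) ⟩
  prodQ q m * prodFrom q m (suc k)                 ∎
  where open ≡-Reasoning

mixedRadixBound : ∀ {x y R Q} → x < R → y < Q → x * Q + y < R * Q
mixedRadixBound {x} {y} {R} {Q} x<R y<Q = begin-strict
  x * Q + y    <⟨ ℕP.+-monoʳ-< (x * Q) y<Q ⟩
  x * Q + Q    ≡⟨ ℕP.+-comm (x * Q) Q ⟩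
  suc x * Q    ≤⟨ ℕP.*-monoˡ-≤ Q x<R ⟩
  R * Q        ∎
  where open ℕP.≤-Reasoning

numerator-growth : ∀ q D m → numerator q D m ≡ + 0 → (∀ n → 1 ≤ n → ℤ.∣ D n ∣ < q n) →
                   ∀ k → ℤ.∣ numerator q D (m + k) ∣ < prodFrom q m k
numerator-growth q D m N≡0 small zero rewrite ℕP.+-identityʳ m | N≡0 = s≤s z≤n
numerator-growth q D m N≡0 small (suc k) rewrite ℕP.+-suc m k = begin-strict
  ℤ.∣ N ℤ.* + Q ℤ.+ D n ∣          ≤⟨ ℤP.∣i+j∣≤∣i∣+∣j∣ (N ℤ.* + Q) (D n) ⟩
  ℤ.∣ N ℤ.* + Q ∣ + ℤ.∣ D n ∣      ≡⟨ cong (_+ ℤ.∣ D n ∣) (ℤP.∣i*j∣≡∣i∣*∣j∣ N (+ Q)) ⟩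
  ℤ.∣ N ∣ * Q + ℤ.∣ D n ∣          <⟨ mixedRadixBound (numerator-growth q D m N≡0 small k) (small n (s≤s z≤n)) ⟩
  prodFrom q m k * Q               ∎
  where
  open ℕP.≤-Reasoning
  n = suc (m + k)
  N = numerator q D (m + k)
  Q = q n

smallFraction : ∀ d P R → 1 ≤ P → d < R → mkℚᵘ (+ d) (P * R ∸ 1) ℚᵘ.≤ mkℚᵘ (+ 1) (P ∸ 1)
smallFraction d P@(suc _) R@(suc _) _ d<R =
  *≤* (subst₂ ℤ._≤_ (ℤP.pos-* d P) (sym (ℤP.*-identityˡ (+ (P * R)))) (+≤+ dP≤PR))
  where
  dP≤PR : d * P ≤ P * R
  dP≤PR = ℕP.≤-trans (ℕP.*-monoˡ-≤ P (ℕP.<⇒≤ d<R)) (ℕP.≤-reflexive (ℕP.*-comm R P))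

partialSums-close : ∀ {q} → IsBasic q → ∀ E₁ E₂ m →
  (∀ n → 1 ≤ n → ℤ.∣ E₁ n ℤ.- E₂ n ∣ < q n) → (∀ n → 1 ≤ n → n ≤ m → E₁ n ≡ E₂ n) →
  ∀ n → m ≤ n → ℚ.∣ partialSum q E₁ n ℚ.- partialSum q E₂ n ∣ ℚ.≤ frac (+ 1) (prodQ q m)
partialSums-close {q} basic E₁ E₂ m small agree n m≤n =
  subst (λ n → ℚ.∣ partialSum q E₁ n ℚ.- partialSum q E₂ n ∣ ℚ.≤ frac (+ 1) (prodQ q m))
        (ℕP.m+[n∸m]≡n m≤n) (closeAfter (n ∸ m))
  where
  D : ℕ → ℤ
  D k = E₁ k ℤ.- E₂ k
  crossLeft≡0 : numerator q D m ≡ + 0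
  crossLeft≡0 = numerator-vanishes q D m
    (λ k 1≤k k≤m → trans (cong (ℤ._- E₂ k) (agree k 1≤k k≤m)) (ℤP.+-inverseʳ (E₂ k)))
  closeAfter : ∀ k → ℚ.∣ partialSum q E₁ (m + k) ℚ.- partialSum q E₂ (m + k) ∣ ℚ.≤ frac (+ 1) (prodQ q m)
  closeAfter k = ℚP.toℚᵘ-cancel-≤ (begin
    toℚᵘ ℚ.∣ s₁ ℚ.- s₂ ∣                              ≃⟨ ℚP.toℚᵘ-homo-∣-∣ (s₁ ℚ.- s₂) ⟩
    ℚᵘ.∣ toℚᵘ (s₁ ℚ.- s₂) ∣                           ≃⟨ ℚᵘP.∣-∣-cong (partialSumDifference≃ basic E₁ E₂ (m + k)) ⟩
    mkℚᵘ (+ ℤ.∣ N ∣) (prodQ q (m + k) ∸ 1)            ≡⟨ cong (λ P → mkℚᵘ (+ ℤ.∣ N ∣) (P ∸ 1)) (prodQ-split q m k) ⟩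
    mkℚᵘ (+ ℤ.∣ N ∣) (prodQ q m * prodFrom q m k ∸ 1) ≤⟨ smallFraction ℤ.∣ N ∣ (prodQ q m) (prodFrom q m k)
                                                            (prodQ-positive basic m)
                                                            (numerator-growth q D m crossLeft≡0 small k) ⟩
    mkℚᵘ (+ 1) (prodQ q m ∸ 1)                        ≃⟨ frac≃ (+ 1) (prodQ q m) (prodQ-positive basic m) ⟨
    toℚᵘ (frac (+ 1) (prodQ q m))                     ∎)
    where
    open ℚᵘP.≤-Reasoning
    s₁ = partialSum q E₁ (m + k)
    s₂ = partialSum q E₂ (m + k)
    N = numerator q D (m + k)

partialSum-cong : ∀ q E₁ E₂ → (∀ n → 1 ≤ n → E₁ n ≡ E₂ n) → ∀ n → partialSum q E₁ n ≡ partialSum q E₂ n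
partialSum-cong q E₁ E₂ same zero = refl
partialSum-cong q E₁ E₂ same (suc n) =
  cong₂ (λ s e → s ℚ.+ frac e (prodQ q (suc n))) (partialSum-cong q E₁ E₂ same n) (same (suc n) (s≤s z≤n))

eventualBound⇒limitBound : ∀ (s₁ s₂ : ℕ → ℚ) δ N →
  (∀ n → N ≤ n → ℚ.∣ s₁ n ℚ.- s₂ n ∣ ℚ.≤ δ) → LimAbsDiffLe s₁ s₂ δ
eventualBound⇒limitBound s₁ s₂ δ N bound ε ε>0 = N , λ n N≤n → ℚP.≤-trans (bound n N≤n) δ≤δ+ε
  where
  δ≤δ+ε : δ ℚ.≤ δ ℚ.+ ε
  δ≤δ+ε = subst (ℚ._≤ δ ℚ.+ ε) (ℚP.+-identityʳ δ) (ℚP.+-monoʳ-≤ δ (ℚP.<⇒≤ ε>0))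

mainTheorem17 : (q : ℕ → ℕ) → IsBasic q → InfiniteInLimit q →
    (ν : ℕ → ℕ) → (∀ j → 1 ≤ j → IsNu q j (ν j)) →
    (l : ℕ → ℕ) → IsL ν l →
    (F₁ F₂ : ℕ → ℕ → ℕ → ℤ) → IsSpecial q l F₁ → IsSpecial q l F₂ →
    (E₁ E₂ : ℕ → ℤ) → IsDigits l F₁ E₁ → IsDigits l F₂ E₂ →
    (δ : ℚ) → IsDist q l F₁ F₂ E₁ E₂ δ →
    LimAbsDiffLe (partialSum q E₁) (partialSum q E₂) δ
-- F₁ = F₂: the digit sequences and hence all partial sums coincide.
mainTheorem17 q _ _ ν _ l isL _ _ _ _ E₁ E₂ digits₁ digits₂ _ (inj₁ (same , refl)) =
  eventualBound⇒limitBound (partialSum q E₁) (partialSum q E₂) 0ℚ 0 λ n _ → ℚP.≤-reflexive (distance≡0 n)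
  where
  sameDigits : ∀ n → 1 ≤ n → E₁ n ≡ E₂ n
  sameDigits = digitsInherit (λ n e → e ≡ E₂ n) (blockCountPositive {ν} isL) digits₁
                 (λ a b c abc∈S → trans (same a b c abc∈S) (sym (digits₂ a b c abc∈S)))
  distance≡0 : ∀ n → ℚ.∣ partialSum q E₁ n ℚ.- partialSum q E₂ n ∣ ≡ 0ℚ
  distance≡0 n = cong ℚ.∣_∣ (trans (cong (ℚ._- partialSum q E₂ n) (partialSum-cong q E₁ E₂ sameDigits n))
                                   (ℚP.+-inverseʳ (partialSum q E₂ n)))
-- F₁ ≠ F₂ with first differing digit at ζ = m + 1: the digits agree up to m.
mainTheorem17 _ _ _ _ _ _ _ _ _ _ _ _ _ _ _ _ (inj₂ (zero , (() , _) , _))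
mainTheorem17 q basic _ ν _ l isL _ _ special₁ special₂ E₁ E₂ digits₁ digits₂ δ
              (inj₂ (suc m , (_ , _ , agreeBefore) , refl)) =
  eventualBound⇒limitBound (partialSum q E₁) (partialSum q E₂) δ m
    (partialSums-close basic E₁ E₂ m digitGap (λ n 1≤n n≤m → agreeBefore n 1≤n (s≤s n≤m)))
  where
  admissible : ∀ {F E} → IsSpecial q l F → IsDigits l F E → ∀ n → 1 ≤ n → DigitIn (q n) (E n)
  admissible special digits =
    digitsInherit (λ n → DigitIn (q n)) (blockCountPositive {ν} isL) digits (specialValueInRange basic special)
  digitGap : ∀ n → 1 ≤ n → ℤ.∣ E₁ n ℤ.- E₂ n ∣ < q n
  digitGap n 1≤n =
    digitDifference (admissible {E = E₁} special₁ digits₁ n 1≤n) (admissible {E = E₂} special₂ digits₂ n 1≤n)
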